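{- For every non-negative integer $n$, \[ \sum_{k=0}^{2n}(-1)^k\binom{2n}{k} C(2n,k)\, C(2n,2n-k)=(-1)^n\cdot C^{(3)}_n\cdot C_n\cdot (2n^2+n+1), \] where $C(N,k)=\frac{N-k+1}{N+1}\binom{N+k}{N}$ for integers $0\le k\le N$, $C_n=\frac{1}{n+1}\binom{2n}{n}$ is the $n$-th Catalan number, and $C^{(3)}_n=\frac{1}{2n+1}\binom{3n}{n}$ is the Fuss--Catalan number of order three.
   Context: $C(N,k)$ (for $0\le k\le N$) are the entries of the Catalan triangle: $C(N,k)$ is the number of lattice paths from $(0,0)$ to $(N,k)$ with steps $(1,0)$ and $(0,1)$ that never rise above the line $y=x$; explicitly $C(N,k)=\frac{N-k+1}{N+1}\binom{N+k}{N}$. -}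

module Defs where

open import Data.Nat using (ℕ; zero; suc; _+_; _*_; _∸_)
open import Data.Nat.DivMod using (_/_)
open import Data.Nat.Combinatorics using (_C_)
open import Data.Integer as ℤ using (ℤ; +_)
open import Data.List using (List; map; upTo)
import Data.List as L

-- Catalan triangle entry C(N,k) = (N-k+1)/(N+1) * binom(N+k, N), for 0 ≤ k ≤ N.
-- The numerator (N-k+1)*binom(N+k,N) is divisible by N+1 (exact division).
catTri : ℕ → ℕ → ℕ
catTri N k = ((N ∸ k + 1) * ((N + k) C N)) / suc N

catalan : ℕ → ℕ
catalan n = ((2 * n) C n) / suc n

fussCatalan3 : ℕ → ℕ
fussCatalan3 n = ((3 * n) C n) / suc (2 * n)

sgn : ℕ → ℤ
sgn zero = + 1
sgn (suc k) = ℤ.- sgn k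

-- Σ_{k=0}^{m} f k  (inclusive upper bound)
sumTo : ℕ → (ℕ → ℤ) → ℤ
sumTo m f = L.foldr ℤ._+_ (+ 0) (map f (upTo (suc m)))

{-# OPTIONS --safe #-}
module Submission where

-- The summand F(N,k) = (-1)^k binom(N,k) C(N,k) C(N,N-k) is hypergeometric, and creative
-- telescoping yields a companion G(N,k) = (-1)^k Y(N,k) A(N,k), with Y an explicit polynomial and
-- A a product of three binomials, such that for N ≥ 2 and 0 ≤ k ≤ N + 2
--   N(N+1)(N+2)(N+3) (p₀(N) F(N,k) + p₂(N) F(N+2,k)) = G(N,k+1) - G(N,k).
-- G vanishes at k = 0 and k = N + 3, so summing over k gives p₀(N) S(N) + p₂(N) S(N+2) = 0.
-- Multiplied by a common factorial normaliser, the four hypergeometric terms become polynomial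
-- multiples of (N+k)! (2N-k)!, which reduces the telescoping identity to a polynomial identity in
-- N and k.  The right-hand side R(n) obeys the same first-order recurrence in n = N/2, because the
-- product of the Fuss–Catalan and Catalan numbers grows by 3(3n+1)(3n+2)(2n+1)/((n+1)(n+2)(2n+3));
-- since p₂ never vanishes, S(2n) = R(n) follows from the cases n = 0 and n = 1.

open import Function using (_∘_)
open import Data.Nat as ℕ using (ℕ; zero; suc; _∸_; _!; _<_; _≤_; s≤s; z≤n)
import Data.Nat.Properties as ℕP
open import Data.Nat.DivMod using (_/_; m/n*n≡m; m*n/n≡m)
open import Data.Nat.Divisibility using (divides)
open import Data.Nat.Combinatorics
  using (_C_; nCk≡n!/k![n-k]!; k![n∸k]!∣n!; k>n⇒nCk≡0; nCk≡nC[n∸k])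
open import Data.Integer as ℤ using (ℤ; +_; 0ℤ)
import Data.Integer.Properties as ℤP
open import Data.List using (foldr; map; applyUpTo)
open import Relation.Binary.PropositionalEquality
open import Level using (0ℓ)
open import Algebra.Bundles.Raw using (RawSemiring; RawRing)
import Data.Nat.Tactic.RingSolver as ℕ-Solver
import Data.Integer.Tactic.RingSolver as ℤ-Solver

open import Defs

module FiniteSums where

  open import Data.Integer using (_+_; _-_; _*_)

  ∑< : ℕ → (ℕ → ℤ) → ℤ
  ∑< zero    u = 0ℤ
  ∑< (suc n) u = u 0 + ∑< n (u ∘ suc)

  foldr-applyUpTo : ∀ n (u : ℕ → ℤ) (h : ℕ → ℕ) →
                    foldr _+_ 0ℤ (map u (applyUpTo h n)) ≡ ∑< n (u ∘ h)
  foldr-applyUpTo zero    u h = refl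
  foldr-applyUpTo (suc n) u h = cong (_+_ (u (h 0))) (foldr-applyUpTo n u (h ∘ suc))

  sumTo≡∑< : ∀ m u → sumTo m u ≡ ∑< (suc m) u
  sumTo≡∑< m u = foldr-applyUpTo (suc m) u (λ k → k)

  ∑<-suc : ∀ n u → ∑< (suc n) u ≡ ∑< n u + u n
  ∑<-suc zero    u = trans (ℤP.+-identityʳ (u 0)) (sym (ℤP.+-identityˡ (u 0)))
  ∑<-suc (suc n) u = trans (cong (_+_ (u 0)) (∑<-suc n (u ∘ suc))) (sym (ℤP.+-assoc (u 0) _ _))

  ∑<-telescope : ∀ n (g : ℕ → ℤ) → ∑< n (λ k → g (suc k) - g k) ≡ g n - g 0
  ∑<-telescope zero    g = sym (ℤP.+-inverseʳ (g 0))
  ∑<-telescope (suc n) g =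
    trans (cong (_+_ (g 1 - g 0)) (∑<-telescope n (g ∘ suc))) (collapse (g 1) (g 0) (g (suc n)))
    where
    collapse : ∀ a b c → a - b + (c - a) ≡ c - b
    collapse = ℤ-Solver.solve-∀

  ∑<-linear : ∀ n a b (u v : ℕ → ℤ) → ∑< n (λ k → a * u k + b * v k) ≡ a * ∑< n u + b * ∑< n v
  ∑<-linear zero    a b u v = sym (cong₂ _+_ (ℤP.*-zeroʳ a) (ℤP.*-zeroʳ b))
  ∑<-linear (suc n) a b u v =
    trans (cong (_+_ (a * u 0 + b * v 0)) (∑<-linear n a b (u ∘ suc) (v ∘ suc)))
          (distribute a b (u 0) (v 0) (∑< n (u ∘ suc)) (∑< n (v ∘ suc)))
    where
    distribute : ∀ a b x y s t → a * x + b * y + (a * s + b * t) ≡ a * (x + s) + b * (y + t)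
    distribute = ℤ-Solver.solve-∀

  ∑<-pad : ∀ n j (u : ℕ → ℤ) → (∀ k → n ≤ k → u k ≡ 0ℤ) → ∑< (n ℕ.+ j) u ≡ ∑< n u
  ∑<-pad n zero    u u≡0 = cong (λ m → ∑< m u) (ℕP.+-identityʳ n)
  ∑<-pad n (suc j) u u≡0 = begin
    ∑< (n ℕ.+ suc j) u          ≡⟨ cong (λ m → ∑< m u) (ℕP.+-suc n j) ⟩
    ∑< (suc (n ℕ.+ j)) u        ≡⟨ ∑<-suc (n ℕ.+ j) u ⟩
    ∑< (n ℕ.+ j) u + u (n ℕ.+ j) ≡⟨ cong₂ _+_ (∑<-pad n j u u≡0) (u≡0 (n ℕ.+ j) (ℕP.m≤m+n n j)) ⟩
    ∑< n u + 0ℤ                 ≡⟨ ℤP.+-identityʳ (∑< n u) ⟩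
    ∑< n u                      ∎
    where open ≡-Reasoning

  ∑<-cong : ∀ n (u v : ℕ → ℤ) → (∀ k → k < n → u k ≡ v k) → ∑< n u ≡ ∑< n v
  ∑<-cong zero    u v u≗v = refl
  ∑<-cong (suc n) u v u≗v =
    cong₂ _+_ (u≗v 0 (s≤s z≤n)) (∑<-cong n (u ∘ suc) (v ∘ suc) (λ k k<n → u≗v (suc k) (s≤s k<n)))

module FirstOrderRecurrence where

  open import Data.Integer using (_+_; _*_)
  open import Algebra.Properties.AbelianGroup ℤP.+-0-abelianGroup using (∙-cancelˡ)

  recurrence-unique : ∀ (a b u v : ℕ → ℤ) → (∀ n → ℤ.NonZero (b n)) →
    (∀ n → a n * u n + b n * u (suc n) ≡ 0ℤ) → (∀ n → a n * v n + b n * v (suc n) ≡ 0ℤ) →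
    u 0 ≡ v 0 → ∀ n → u n ≡ v n
  recurrence-unique a b u v b≢0 u-rec v-rec u₀≡v₀ zero    = u₀≡v₀
  recurrence-unique a b u v b≢0 u-rec v-rec u₀≡v₀ (suc n) =
    ℤP.*-cancelˡ-≡ (b n) _ _ {{b≢0 n}} (∙-cancelˡ (a n * u n) _ _ (begin
      a n * u n + b n * u (suc n)  ≡⟨ u-rec n ⟩
      0ℤ                           ≡⟨ v-rec n ⟨
      a n * v n + b n * v (suc n)  ≡⟨ cong (λ x → a n * x + b n * v (suc n)) uₙ≡vₙ ⟨
      a n * u n + b n * v (suc n)  ∎))
    where
    open ≡-Reasoning
    uₙ≡vₙ = recurrence-unique a b u v b≢0 u-rec v-rec u₀≡v₀ n

module Binomials where

  open import Data.Nat using (_+_; _*_)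
  open ≡-Reasoning

  [m+n]Cm*[m!*n!]≡[m+n]! : ∀ m n → ((m + n) C m) * (m ! * n !) ≡ (m + n) !
  [m+n]Cm*[m!*n!]≡[m+n]! m n = begin
    ((m + n) C m) * (m ! * n !)                     ≡⟨ cong (λ j → ((m + n) C m) * (m ! * j !)) (ℕP.m+n∸m≡n m n) ⟨
    ((m + n) C m) * (m ! * (m + n ∸ m) !)           ≡⟨ cong (_* (m ! * (m + n ∸ m) !)) (nCk≡n!/k![n-k]! m≤m+n) ⟩
    (m + n) ! / (m ! * (m + n ∸ m) !) * (m ! * (m + n ∸ m) !) ≡⟨ m/n*n≡m (k![n∸k]!∣n! m≤m+n) ⟩
    (m + n) !                                       ∎
    where
    m≤m+n = ℕP.m≤m+n m n
    instance _ = ℕP._!*_!≢0 m (m + n ∸ m)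

  [1+n]*[n+k]C[1+n]≡k*[n+k]Cn : ∀ n k → suc n * ((n + k) C suc n) ≡ k * ((n + k) C n)
  [1+n]*[n+k]C[1+n]≡k*[n+k]Cn n zero = begin
    suc n * ((n + 0) C suc n)  ≡⟨ cong (suc n *_) (k>n⇒nCk≡0 (s≤s (ℕP.≤-reflexive (ℕP.+-identityʳ n)))) ⟩
    suc n * 0                  ≡⟨ ℕP.*-zeroʳ (suc n) ⟩
    0                          ∎
  [1+n]*[n+k]C[1+n]≡k*[n+k]Cn n (suc j) =
    ℕP.*-cancelʳ-≡ _ _ (n ! * suc j !) {{ℕP._!*_!≢0 n (suc j)}} (begin
      suc n * B′ * (n ! * suc j !)    ≡⟨ shuffle (suc n) B′ (n !) (suc j) (j !) ⟩
      suc j * (B′ * (suc n ! * j !))  ≡⟨ cong (λ m → suc j * ((m C suc n) * (suc n ! * j !))) (ℕP.+-suc n j) ⟩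
      suc j * (((suc n + j) C suc n) * (suc n ! * j !)) ≡⟨ cong (suc j *_) ([m+n]Cm*[m!*n!]≡[m+n]! (suc n) j) ⟩
      suc j * (suc n + j) !           ≡⟨ cong (λ m → suc j * m !) (ℕP.+-suc n j) ⟨
      suc j * (n + suc j) !           ≡⟨ cong (suc j *_) ([m+n]Cm*[m!*n!]≡[m+n]! n (suc j)) ⟨
      suc j * (B * (n ! * suc j !))   ≡⟨ ℕP.*-assoc (suc j) B _ ⟨
      suc j * B * (n ! * suc j !)     ∎)
    where
    B = (n + suc j) C n
    B′ = (n + suc j) C suc n
    shuffle : ∀ a b c d e → a * b * (c * (d * e)) ≡ d * (b * (a * c * e))
    shuffle = ℕ-Solver.solve-∀

  module _ {n k : ℕ} (k≤n : k ≤ n) where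

    private
      B = (n + k) C n
      B′ = (n + k) C suc n

      [n∸k+1]*B≡[B∸B′]*[1+n] : (n ∸ k + 1) * B ≡ (B ∸ B′) * suc n
      [n∸k+1]*B≡[B∸B′]*[1+n] = begin
        (n ∸ k + 1) * B          ≡⟨ cong (_* B) (ℕP.+-comm (n ∸ k) 1) ⟩
        (1 + (n ∸ k)) * B        ≡⟨ cong (_* B) (ℕP.+-∸-assoc 1 k≤n) ⟨
        (suc n ∸ k) * B          ≡⟨ ℕP.*-distribʳ-∸ B (suc n) k ⟩
        suc n * B ∸ k * B        ≡⟨ cong (suc n * B ∸_) ([1+n]*[n+k]C[1+n]≡k*[n+k]Cn n k) ⟨
        suc n * B ∸ suc n * B′   ≡⟨ ℕP.*-distribˡ-∸ (suc n) B B′ ⟨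
        suc n * (B ∸ B′)         ≡⟨ ℕP.*-comm (suc n) (B ∸ B′) ⟩
        (B ∸ B′) * suc n         ∎

    catTri≡[n+k]Cn∸[n+k]C[1+n] : catTri n k ≡ B ∸ B′
    catTri≡[n+k]Cn∸[n+k]C[1+n] = begin
      (n ∸ k + 1) * B / suc n  ≡⟨ cong (_/ suc n) [n∸k+1]*B≡[B∸B′]*[1+n] ⟩
      (B ∸ B′) * suc n / suc n ≡⟨ m*n/n≡m (B ∸ B′) (suc n) ⟩
      B ∸ B′                   ∎

    catTri*[1+n]≡[n∸k+1]*[n+k]Cn : catTri n k * suc n ≡ (n ∸ k + 1) * B
    catTri*[1+n]≡[n∸k+1]*[n+k]Cn = begin
      catTri n k * suc n ≡⟨ cong (_* suc n) catTri≡[n+k]Cn∸[n+k]C[1+n] ⟩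
      (B ∸ B′) * suc n   ≡⟨ [n∸k+1]*B≡[B∸B′]*[1+n] ⟨
      (n ∸ k + 1) * B    ∎

  catalan*[1+n]≡[2n]Cn : ∀ n → catalan n * suc n ≡ (2 * n) C n
  catalan*[1+n]≡[2n]Cn n = m/n*n≡m (divides (catTri n n) (sym (begin
    catTri n n * suc n              ≡⟨ catTri*[1+n]≡[n∸k+1]*[n+k]Cn {n} {n} ℕP.≤-refl ⟩
    (n ∸ n + 1) * ((n + n) C n)     ≡⟨ cong (λ m → (m + 1) * ((n + n) C n)) (ℕP.n∸n≡0 n) ⟩
    (n + n) C n + 0                 ≡⟨ ℕP.+-identityʳ _ ⟩
    (n + n) C n                     ≡⟨ cong (λ m → (n + m) C n) (ℕP.+-identityʳ n) ⟨
    (2 * n) C n                     ∎)))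

  fussCatalan3*[1+2n]≡[3n]Cn : ∀ n → fussCatalan3 n * suc (2 * n) ≡ (3 * n) C n
  fussCatalan3*[1+2n]≡[3n]Cn n = m/n*n≡m (divides (B ∸ 2 * B′) (sym (begin
    (B ∸ 2 * B′) * suc t                 ≡⟨ ℕP.*-distribʳ-∸ (suc t) B (2 * B′) ⟩
    B * suc t ∸ 2 * B′ * suc t           ≡⟨ cong₂ _∸_ (expand B n) (regroup B′ n) ⟩
    B + 2 * (n * B) ∸ 2 * (suc t * B′)   ≡⟨ cong (λ m → B + 2 * (n * B) ∸ 2 * m) ([1+n]*[n+k]C[1+n]≡k*[n+k]Cn t n) ⟩
    B + 2 * (n * B) ∸ 2 * (n * B)        ≡⟨ ℕP.m+n∸n≡m B (2 * (n * B)) ⟩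
    B                                    ≡⟨ cong (λ m → (t + n) C m) (ℕP.m+n∸n≡m t n) ⟨
    (t + n) C (t + n ∸ n)                ≡⟨ nCk≡nC[n∸k] (ℕP.m≤n+m n t) ⟨
    (t + n) C n                          ≡⟨ cong (_C n) (3n≡2n+n n) ⟨
    (3 * n) C n                          ∎)))
    where
    t = 2 * n
    B = (t + n) C t
    B′ = (t + n) C suc t
    expand : ∀ b n → b * suc (2 * n) ≡ b + 2 * (n * b)
    expand = ℕ-Solver.solve-∀
    regroup : ∀ b n → 2 * b * suc (2 * n) ≡ 2 * (suc (2 * n) * b)
    regroup = ℕ-Solver.solve-∀
    3n≡2n+n : ∀ n → 3 * n ≡ 2 * n + n
    3n≡2n+n = ℕ-Solver.solve-∀

-- +_ commutes with multiplication only propositionally (pos-*), so ℕ identities are transported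
-- to ℤ along an explicit expression tree.
module NaturalCast where

  infixl 6 _⊕_
  infixl 7 _⊗_

  data Expr : Set where
    ⌜_⌝     : ℕ → Expr
    _⊕_ _⊗_ : Expr → Expr → Expr

  ⟦_⟧ℕ : Expr → ℕ
  ⟦ ⌜ m ⌝ ⟧ℕ = m
  ⟦ e ⊕ f ⟧ℕ = ⟦ e ⟧ℕ ℕ.+ ⟦ f ⟧ℕ
  ⟦ e ⊗ f ⟧ℕ = ⟦ e ⟧ℕ ℕ.* ⟦ f ⟧ℕ

  ⟦_⟧ℤ : Expr → ℤ
  ⟦ ⌜ m ⌝ ⟧ℤ = + m
  ⟦ e ⊕ f ⟧ℤ = ⟦ e ⟧ℤ ℤ.+ ⟦ f ⟧ℤ
  ⟦ e ⊗ f ⟧ℤ = ⟦ e ⟧ℤ ℤ.* ⟦ f ⟧ℤ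

  +⟦e⟧ℕ≡⟦e⟧ℤ : ∀ e → + ⟦ e ⟧ℕ ≡ ⟦ e ⟧ℤ
  +⟦e⟧ℕ≡⟦e⟧ℤ ⌜ m ⌝   = refl
  +⟦e⟧ℕ≡⟦e⟧ℤ (e ⊕ f) = cong₂ ℤ._+_ (+⟦e⟧ℕ≡⟦e⟧ℤ e) (+⟦e⟧ℕ≡⟦e⟧ℤ f)
  +⟦e⟧ℕ≡⟦e⟧ℤ (e ⊗ f) =
    trans (ℤP.pos-* ⟦ e ⟧ℕ ⟦ f ⟧ℕ) (cong₂ ℤ._*_ (+⟦e⟧ℕ≡⟦e⟧ℤ e) (+⟦e⟧ℕ≡⟦e⟧ℤ f))

  cast : ∀ e f → ⟦ e ⟧ℕ ≡ ⟦ f ⟧ℕ → ⟦ e ⟧ℤ ≡ ⟦ f ⟧ℤ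
  cast e f eq = trans (sym (+⟦e⟧ℕ≡⟦e⟧ℤ e)) (trans (cong +_ eq) (+⟦e⟧ℕ≡⟦e⟧ℤ f))

  exprRawSemiring : RawSemiring 0ℓ 0ℓ
  exprRawSemiring = record
    { Carrier = Expr ; _≈_ = _≡_ ; _+_ = _⊕_ ; _*_ = _⊗_ ; 0# = ⌜ 0 ⌝ ; 1# = ⌜ 1 ⌝ }

-- The polynomials are written once over an arbitrary (semi)ring with literals ι, so that the same
-- text is read in ℕ, in ℤ, as a cast expression and as ring-solver syntax, where the identities of
-- IntegerPolynomials are checked by normalisation.  The ratio polynomials take the shifted variables
-- b = n - κ, c = n + 2 - κ and d = 2n - κ, which keeps them subtraction-free.
module SemiringPolynomials (R : RawSemiring 0ℓ 0ℓ) (ι : ℕ → RawSemiring.Carrier R) where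

  open RawSemiring R

  p₀ : Carrier → Carrier
  p₀ n = ι 3 * (ι 4 + ι 3 * n) * (ι 2 + ι 3 * n) * (ι 1 + n) * (ι 8 + ι 5 * n + n * n)

  p₂ : Carrier → Carrier
  p₂ n = (ι 2 + n) * (ι 3 + n) * (ι 4 + n) * (ι 2 + n + n * n)

  rising₄ : Carrier → Carrier
  rising₄ n = n * (ι 1 + n) * (ι 2 + n) * (ι 3 + n)

  δ : Carrier → Carrier
  δ n = (ι 1 + n) * (ι 1 + n) * (ι 2 + n) * ((ι 3 + n) * (ι 3 + n))

  F₀-ratio : Carrier → Carrier → Carrier → Carrier
  F₀-ratio n κ b =
    (ι 2 + n) * ((ι 3 + n) * (ι 3 + n)) * ((ι 1 + b) * (ι 1 + b) * (ι 1 + b) * (ι 1 + κ) * ((ι 2 + b) * (ι 2 + b)))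

  F₂-ratio : Carrier → Carrier → Carrier → Carrier → Carrier
  F₂-ratio n κ c d =
    (ι 1 + n) * ((ι 1 + c) * (ι 1 + κ) * (ι 1 + n + κ) * (ι 2 + n + κ) * ((ι 1 + d) * (ι 2 + d) * (ι 3 + d) * (ι 4 + d)))

  G₀-ratio : Carrier → Carrier → Carrier → Carrier
  G₀-ratio n κ d = κ * κ * n * (ι 1 + d) * δ n

  G₁-ratio : Carrier → Carrier → Carrier → Carrier
  G₁-ratio n κ c = c * c * n * (ι 1 + n + κ) * δ n

  q : Carrier → Carrier
  q n = ι 2 * n * n + n + ι 1

  growthNumerator : Carrier → Carrier
  growthNumerator n = ι 3 * (ι 1 + ι 3 * n) * (ι 2 + ι 3 * n) * (ι 1 + ι 2 * n)

  growthDenominator : Carrier → Carrier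
  growthDenominator n = (ι 1 + n) * (ι 2 + n) * (ι 3 + ι 2 * n)

module RingPolynomials (R : RawRing 0ℓ 0ℓ) (ι : ℕ → RawRing.Carrier R) where

  open RawRing R
  open SemiringPolynomials rawSemiring ι public

  private
    infixl 6 _-_
    _-_ : Carrier → Carrier → Carrier
    x - y = x + - y

  Y : Carrier → Carrier → Carrier
  Y n κ = (((((y₆ * κ + y₅) * κ + y₄) * κ + y₃) * κ + y₂) * κ + y₁) * κ + y₀
    where
    y₆ = ((n + ι 3) * n + ι 4) * n + ι 4
    y₅ = - ((((ι 6 * n + ι 29) * n + ι 57) * n + ι 68) * n + ι 44)
    y₄ = ((((ι 35 * n + ι 323) * n + ι 1216) * n + ι 2288) * n + ι 2042) * n + ι 652
    y₃ = - ((((((ι 95 * n + ι 1131) * n + ι 5505) * n + ι 13856) * n + ι 18593) * n + ι 12260) * n + ι 2948)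
    y₂ = ((((((ι 108 * n + ι 1516) * n + ι 8863) * n + ι 27721) * n + ι 49289) * n + ι 48597) * n + ι 23546) * n + ι 3856
    y₁ = ι 2128 - (((((((ι 43 * n + ι 694) * n + ι 4743) * n + ι 17703) * n + ι 38540) * n + ι 47851) * n + ι 29570) * n + ι 4568) * n
    y₀ = - ((((((ι 86 * n + ι 1174) * n + ι 6322) * n + ι 17154) * n + ι 24840) * n + ι 18296) * n + ι 5376)

  ρF₀ ρF₂ ρG₀ ρG₁ : Carrier → Carrier → Carrier
  ρF₀ n κ = F₀-ratio n κ (n - κ)
  ρF₂ n κ = F₂-ratio n κ (ι 2 + n - κ) (ι 2 * n - κ)
  ρG₀ n κ = G₀-ratio n κ (ι 2 * n - κ)
  ρG₁ n κ = G₁-ratio n κ (ι 2 + n - κ)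

  closed-form-combination : Carrier → Carrier
  closed-form-combination n =
    p₀ (ι 2 * n) * growthDenominator n * q n - p₂ (ι 2 * n) * q (ι 1 + n) * growthNumerator n

  wz-combination : Carrier → Carrier → Carrier
  wz-combination n κ =
    rising₄ n * p₀ n * ρF₀ n κ + rising₄ n * p₂ n * ρF₂ n κ + Y n (ι 1 + κ) * ρG₁ n κ + Y n κ * ρG₀ n κ

module SolverSyntax where

  open import Data.Integer.Solver using (module +-*-Solver)
  open +-*-Solver public

  polynomialRawRing : ℕ → RawRing 0ℓ 0ℓ
  polynomialRawRing m = record
    { Carrier = Polynomial m ; _≈_ = _≡_ ; _+_ = _:+_ ; _*_ = _:*_ ; -_ = :-_
    ; 0# = con 0ℤ ; 1# = con (+ 1) }

  module Symbolic (m : ℕ) = RingPolynomials (polynomialRawRing m) (λ i → con (+ i))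

module IntegerPolynomials where

  open RingPolynomials ℤ.+-*-rawRing +_ public
  open SolverSyntax
  open NaturalCast using (⌜_⌝; +⟦e⟧ℕ≡⟦e⟧ℤ; exprRawSemiring)
  private module E = SemiringPolynomials exprRawSemiring ⌜_⌝

  wz-certificate : ∀ n κ → wz-combination n κ ≡ 0ℤ
  wz-certificate = solve 2 (λ n κ → S.wz-combination n κ := con 0ℤ) refl
    where module S = Symbolic 2

  closed-form-certificate : ∀ n → closed-form-combination n ≡ 0ℤ
  closed-form-certificate = solve 1 (λ n → S.closed-form-combination n := con 0ℤ) refl
    where module S = Symbolic 1

  ρF₀[n,1+n]≡0 : ∀ n → ρF₀ n (+ 1 ℤ.+ n) ≡ 0ℤ
  ρF₀[n,1+n]≡0 = solve 1 (λ n → S.ρF₀ n (con (+ 1) :+ n) := con 0ℤ) refl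
    where module S = Symbolic 1

  ρF₀[n,2+n]≡0 : ∀ n → ρF₀ n (+ 2 ℤ.+ n) ≡ 0ℤ
  ρF₀[n,2+n]≡0 = solve 1 (λ n → S.ρF₀ n (con (+ 2) :+ n) := con 0ℤ) refl
    where module S = Symbolic 1

  rising₄[1+n]-nonZero : ∀ n → ℤ.NonZero (rising₄ (+ suc n))
  rising₄[1+n]-nonZero n = subst ℤ.NonZero (+⟦e⟧ℕ≡⟦e⟧ℤ (E.rising₄ ⌜ suc n ⌝)) _

  p₂-nonZero : ∀ n → ℤ.NonZero (p₂ (+ n))
  p₂-nonZero n = subst ℤ.NonZero (+⟦e⟧ℕ≡⟦e⟧ℤ (E.p₂ ⌜ n ⌝)) _

  growthDenominator-nonZero : ∀ n → ℤ.NonZero (growthDenominator (+ n))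
  growthDenominator-nonZero n = subst ℤ.NonZero (+⟦e⟧ℕ≡⟦e⟧ℤ (E.growthDenominator ⌜ n ⌝)) _

module FactorialForms where

  open import Data.Nat using (_+_; _*_)
  open Binomials
  open ≡-Reasoning

  summand : ℕ → ℕ → ℕ
  summand N k = (N C k) * catTri N k * catTri N (N ∸ k)

  companion : ℕ → ℕ → ℕ
  companion N zero    = 0
  companion N (suc j) = ((j + suc N) C j) * ((2 * N ∸ j) C (N ∸ 1)) * (suc N C j)

  -- With c = N + 2 - k and d = 2N - k, δ(N) · U N k c times any of summand N k, summand (2 + N) k,
  -- companion N k and companion N (suc k) is a polynomial multiple of X N k d.
  U : ℕ → ℕ → ℕ → ℕ
  U N k c = k ! * k ! * (c ! * c !) * N !

  X : ℕ → ℕ → ℕ → ℕ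
  X N k d = (N + k) ! * d !

  U-nonZero : ∀ N k c → ℕ.NonZero (U N k c)
  U-nonZero N k c = m*n≢0 (k ! * k ! * (c ! * c !)) (N !) {{m*n≢0 (k ! * k !) (c ! * c !)}}
    where
    open ℕP using (m*n≢0)
    instance
      _ = ℕP._!≢0 k
      _ = ℕP._!≢0 c
      _ = ℕP._!≢0 N
      _ = m*n≢0 (k !) (k !)
      _ = m*n≢0 (c !) (c !)

  summand-vanishes : ∀ {N k} → N < k → summand N k ≡ 0
  summand-vanishes {N} {k} N<k = cong (λ x → x * catTri N k * catTri N (N ∸ k)) (k>n⇒nCk≡0 N<k)

  companion-vanishes : ∀ N → companion N (3 + N) ≡ 0
  companion-vanishes N = begin
    a₁ * a₂ * (suc N C (2 + N))  ≡⟨ cong (a₁ * a₂ *_) (k>n⇒nCk≡0 {suc N} ℕP.≤-refl) ⟩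
    a₁ * a₂ * 0                  ≡⟨ ℕP.*-zeroʳ (a₁ * a₂) ⟩
    0                            ∎
    where
    a₁ = (2 + N + suc N) C (2 + N)
    a₂ = (2 * N ∸ (2 + N)) C (N ∸ 1)

  summand-factorial : ∀ k b → let N = k + b in
    suc N * suc N * U N k b * summand N k ≡ (b + 1) * (k + 1) * X N k (N + b)
  summand-factorial k b = begin
    suc N * suc N * U N k b * ((N C k) * catTri N k * catTri N (N ∸ k))
      ≡⟨ cong (λ j → suc N * suc N * U N k b * ((N C k) * catTri N k * catTri N j)) (ℕP.m+n∸m≡n k b) ⟩
    suc N * suc N * U N k b * ((N C k) * catTri N k * catTri N b)
      ≡⟨ regroup (suc N) (k !) (b !) (N !) (N C k) (catTri N k) (catTri N b) ⟩
    catTri N k * suc N * (catTri N b * suc N) * ((N C k) * (k ! * b !)) * (k ! * b ! * N !)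
      ≡⟨ cong₂ (λ x y → x * y * ((N C k) * (k ! * b !)) * (k ! * b ! * N !)) catTri-k catTri-b ⟩
    (b + 1) * B₁ * ((k + 1) * B₂) * ((N C k) * (k ! * b !)) * (k ! * b ! * N !)
      ≡⟨ cong (λ x → (b + 1) * B₁ * ((k + 1) * B₂) * x * (k ! * b ! * N !)) ([m+n]Cm*[m!*n!]≡[m+n]! k b) ⟩
    (b + 1) * B₁ * ((k + 1) * B₂) * N ! * (k ! * b ! * N !)
      ≡⟨ regroup′ (b + 1) (k + 1) B₁ B₂ (N !) (k !) (b !) ⟩
    (b + 1) * (k + 1) * (B₁ * (N ! * k !) * (B₂ * (N ! * b !)))
      ≡⟨ cong₂ (λ x y → (b + 1) * (k + 1) * (x * y)) ([m+n]Cm*[m!*n!]≡[m+n]! N k) ([m+n]Cm*[m!*n!]≡[m+n]! N b) ⟩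
    (b + 1) * (k + 1) * ((N + k) ! * (N + b) !)
      ∎
    where
    N = k + b
    B₁ = (N + k) C N
    B₂ = (N + b) C N
    catTri-k : catTri N k * suc N ≡ (b + 1) * B₁
    catTri-k = trans (catTri*[1+n]≡[n∸k+1]*[n+k]Cn (ℕP.m≤m+n k b))
                     (cong (λ j → (j + 1) * B₁) (ℕP.m+n∸m≡n k b))
    catTri-b : catTri N b * suc N ≡ (k + 1) * B₂
    catTri-b = trans (catTri*[1+n]≡[n∸k+1]*[n+k]Cn (ℕP.m≤n+m b k))
                     (cong (λ j → (j + 1) * B₂) (ℕP.m+n∸n≡m k b))
    regroup : ∀ s x y m c t₁ t₂ →
      s * s * (x * x * (y * y) * m) * (c * t₁ * t₂) ≡ t₁ * s * (t₂ * s) * (c * (x * y)) * (x * y * m)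
    regroup = ℕ-Solver.solve-∀
    regroup′ : ∀ p q b₁ b₂ m x y →
      p * b₁ * (q * b₂) * m * (x * y * m) ≡ p * q * (b₁ * (m * x) * (b₂ * (m * y)))
    regroup′ = ℕ-Solver.solve-∀

  companion-factorial : ∀ m j c → j + c ≡ 2 + m →
    companion (suc m) (suc j) * (j ! * j ! * (m ! * (c ! * c !))) ≡ (j + (2 + m)) ! * (m + c) !
  companion-factorial m j c j+c≡2+m = ℕP.*-cancelʳ-≡ _ _ ((2 + m) !) {{(2 + m) !≢0}} (begin
    a₁ * a₂ * a₃ * (j ! * j ! * (m ! * (c ! * c !))) * (2 + m) !
      ≡⟨ regroup a₁ a₂ a₃ (j !) (m !) (c !) ((2 + m) !) ⟩
    a₁ * (j ! * (2 + m) !) * (a₂ * (m ! * c !)) * (a₃ * (j ! * c !))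
      ≡⟨ cong₂ (λ x y → x * y * (a₃ * (j ! * c !))) ([m+n]Cm*[m!*n!]≡[m+n]! j (2 + m)) a₂-factorial ⟩
    (j + (2 + m)) ! * (m + c) ! * (a₃ * (j ! * c !))
      ≡⟨ cong ((j + (2 + m)) ! * (m + c) ! *_) a₃-factorial ⟩
    (j + (2 + m)) ! * (m + c) ! * (2 + m) !
      ∎)
    where
    open ℕP using (_!≢0)
    a₁ = (j + (2 + m)) C j
    a₂ = (2 * suc m ∸ j) C m
    a₃ = (2 + m) C j
    2[1+m]∸j≡m+c : 2 * suc m ∸ j ≡ m + c
    2[1+m]∸j≡m+c = begin
      2 * suc m ∸ j      ≡⟨ cong (_∸ j) (double m) ⟩
      m + (2 + m) ∸ j    ≡⟨ cong (λ x → m + x ∸ j) j+c≡2+m ⟨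
      m + (j + c) ∸ j    ≡⟨ cong (_∸ j) (swap m j c) ⟩
      m + c + j ∸ j      ≡⟨ ℕP.m+n∸n≡m (m + c) j ⟩
      m + c              ∎
      where
      double : ∀ m → 2 * suc m ≡ m + (2 + m)
      double = ℕ-Solver.solve-∀
      swap : ∀ m j c → m + (j + c) ≡ m + c + j
      swap = ℕ-Solver.solve-∀
    a₂-factorial : a₂ * (m ! * c !) ≡ (m + c) !
    a₂-factorial = trans (cong (λ x → (x C m) * (m ! * c !)) 2[1+m]∸j≡m+c) ([m+n]Cm*[m!*n!]≡[m+n]! m c)
    a₃-factorial : a₃ * (j ! * c !) ≡ (2 + m) !
    a₃-factorial = subst (λ x → (x C j) * (j ! * c !) ≡ x !) j+c≡2+m ([m+n]Cm*[m!*n!]≡[m+n]! j c)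
    regroup : ∀ a₁ a₂ a₃ x y z w →
      a₁ * a₂ * a₃ * (x * x * (y * (z * z))) * w ≡ a₁ * (x * w) * (a₂ * (y * z)) * (a₃ * (x * z))
    regroup = ℕ-Solver.solve-∀

module NaturalRatios where

  open import Data.Nat using (_+_; _*_)
  open FactorialForms
  open SemiringPolynomials ℕ.+-*-rawSemiring (λ m → m)
  open ≡-Reasoning

  summand-ratio₀ : ∀ k b → let N = k + b in
    δ N * U N k (2 + b) * summand N k ≡ F₀-ratio N k b * X N k (N + b)
  summand-ratio₀ k b = begin
    δ N * U N k (2 + b) * summand N k
      ≡⟨ regroup N b (k !) (b !) (N !) (summand N k) ⟩
    w * (suc N * suc N * U N k b * summand N k)
      ≡⟨ cong (w *_) (summand-factorial k b) ⟩
    w * ((b + 1) * (k + 1) * X N k (N + b))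
      ≡⟨ regroup′ N k b (X N k (N + b)) ⟩
    F₀-ratio N k b * X N k (N + b)
      ∎
    where
    N = k + b
    w = (2 + N) * ((3 + N) * (3 + N)) * ((2 + b) * (2 + b) * ((1 + b) * (1 + b)))
    regroup : ∀ n b x y m p →
      (1 + n) * (1 + n) * (2 + n) * ((3 + n) * (3 + n))
        * (x * x * ((2 + b) * ((1 + b) * y) * ((2 + b) * ((1 + b) * y))) * m) * p
      ≡ (2 + n) * ((3 + n) * (3 + n)) * ((2 + b) * (2 + b) * ((1 + b) * (1 + b)))
        * ((1 + n) * (1 + n) * (x * x * (y * y) * m) * p)
    regroup = ℕ-Solver.solve-∀
    regroup′ : ∀ n k b x →
      (2 + n) * ((3 + n) * (3 + n)) * ((2 + b) * (2 + b) * ((1 + b) * (1 + b))) * ((b + 1) * (k + 1) * x)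
      ≡ (2 + n) * ((3 + n) * (3 + n)) * ((1 + b) * (1 + b) * (1 + b) * (1 + k) * ((2 + b) * (2 + b))) * x
    regroup′ = ℕ-Solver.solve-∀

  summand-ratio₂ : ∀ N k c d → k + c ≡ 2 + N → k + d ≡ 2 * N →
    δ N * U N k c * summand (2 + N) k ≡ F₂-ratio N k c d * X N k d
  summand-ratio₂ N k c d k+c≡2+N k+d≡2N = begin
    δ N * U N k c * summand (2 + N) k
      ≡⟨ regroup N (k !) (c !) (N !) (summand (2 + N) k) ⟩
    (1 + N) * ((3 + N) * (3 + N) * U (2 + N) k c * summand (2 + N) k)
      ≡⟨ cong ((1 + N) *_) factorial-form ⟩
    (1 + N) * ((c + 1) * (k + 1) * ((2 + N + k) ! * (2 + N + c) !))
      ≡⟨ cong (λ e → (1 + N) * ((c + 1) * (k + 1) * ((2 + N + k) ! * e !))) 2+N+c≡4+d ⟩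
    (1 + N) * ((c + 1) * (k + 1) * ((2 + N + k) ! * (4 + d) !))
      ≡⟨ regroup′ N k c d ((N + k) !) (d !) ⟩
    F₂-ratio N k c d * X N k d
      ∎
    where
    factorial-form : (3 + N) * (3 + N) * U (2 + N) k c * summand (2 + N) k ≡ (c + 1) * (k + 1) * X (2 + N) k (2 + N + c)
    factorial-form = subst (λ M → suc M * suc M * U M k c * summand M k ≡ (c + 1) * (k + 1) * X M k (M + c))
                           k+c≡2+N (summand-factorial k c)
    2+N+c≡4+d : 2 + N + c ≡ 4 + d
    2+N+c≡4+d = ℕP.+-cancelˡ-≡ k _ _ (begin
      k + (2 + N + c)   ≡⟨ shuffle k N c ⟩
      2 + N + (k + c)   ≡⟨ cong (_+_ (2 + N)) k+c≡2+N ⟩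
      2 + N + (2 + N)   ≡⟨ double N ⟩
      4 + 2 * N         ≡⟨ cong (_+_ 4) k+d≡2N ⟨
      4 + (k + d)       ≡⟨ shuffle′ k d ⟩
      k + (4 + d)       ∎)
      where
      shuffle : ∀ k N c → k + (2 + N + c) ≡ 2 + N + (k + c)
      shuffle = ℕ-Solver.solve-∀
      double : ∀ N → 2 + N + (2 + N) ≡ 4 + 2 * N
      double = ℕ-Solver.solve-∀
      shuffle′ : ∀ k d → 4 + (k + d) ≡ k + (4 + d)
      shuffle′ = ℕ-Solver.solve-∀
    regroup : ∀ n x y m p →
      (1 + n) * (1 + n) * (2 + n) * ((3 + n) * (3 + n)) * (x * x * (y * y) * m) * p
      ≡ (1 + n) * ((3 + n) * (3 + n) * (x * x * (y * y) * ((2 + n) * ((1 + n) * m))) * p)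
    regroup = ℕ-Solver.solve-∀
    regroup′ : ∀ n k c d x y →
      (1 + n) * ((c + 1) * (k + 1) * ((2 + n + k) * ((1 + n + k) * x)
        * ((4 + d) * ((3 + d) * ((2 + d) * ((1 + d) * y))))))
      ≡ (1 + n) * ((1 + c) * (1 + k) * (1 + n + k) * (2 + n + k) * ((1 + d) * (2 + d) * (3 + d) * (4 + d))) * (x * y)
    regroup′ = ℕ-Solver.solve-∀

  companion-ratio₀ : ∀ m k c d → let N = suc m in k + c ≡ 2 + N → k + d ≡ 2 * N →
    δ N * U N k c * companion N k ≡ G₀-ratio N k d * X N k d
  companion-ratio₀ m zero c d _ _ = begin
    δ (suc m) * U (suc m) 0 c * 0  ≡⟨ ℕP.*-zeroʳ (δ (suc m) * U (suc m) 0 c) ⟩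
    0                              ∎
  companion-ratio₀ m (suc j) c d 1+j+c≡3+m 1+j+d≡2N = begin
    δ N * U N k c * companion N k
      ≡⟨ regroup N j (j !) (c !) (m !) (companion N k) ⟩
    δ N * (k * k * N * (companion N k * (j ! * j ! * (m ! * (c ! * c !)))))
      ≡⟨ cong (λ x → δ N * (k * k * N * x)) (companion-factorial m j c (ℕP.suc-injective 1+j+c≡3+m)) ⟩
    δ N * (k * k * N * ((j + (2 + m)) ! * (m + c) !))
      ≡⟨ cong₂ (λ x y → δ N * (k * k * N * (x ! * y !))) (j+[2+m]≡N+k m j) m+c≡1+d ⟩
    δ N * (k * k * N * ((N + k) ! * (1 + d) !))
      ≡⟨ regroup′ (δ N) (k * k * N) d ((N + k) !) (d !) ⟩
    G₀-ratio N k d * X N k d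
      ∎
    where
    N = suc m
    k = suc j
    j+[2+m]≡N+k : ∀ m j → j + (2 + m) ≡ suc m + suc j
    j+[2+m]≡N+k = ℕ-Solver.solve-∀
    m+c≡1+d : m + c ≡ 1 + d
    m+c≡1+d = ℕP.+-cancelˡ-≡ k _ _ (begin
      k + (m + c)   ≡⟨ shuffle j m c ⟩
      m + (1 + j + c) ≡⟨ cong (_+_ m) 1+j+c≡3+m ⟩
      m + (3 + m)   ≡⟨ double m ⟩
      1 + 2 * N     ≡⟨ cong (_+_ 1) 1+j+d≡2N ⟨
      1 + (k + d)   ≡⟨ ℕP.+-suc k d ⟨
      k + (1 + d)   ∎)
      where
      shuffle : ∀ j m c → suc j + (m + c) ≡ m + (1 + j + c)
      shuffle = ℕ-Solver.solve-∀
      double : ∀ m → m + (3 + m) ≡ 1 + 2 * suc m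
      double = ℕ-Solver.solve-∀
    regroup : ∀ n j x y z a →
      (1 + n) * (1 + n) * (2 + n) * ((3 + n) * (3 + n))
        * ((1 + j) * x * ((1 + j) * x) * (y * y) * (n * z)) * a
      ≡ (1 + n) * (1 + n) * (2 + n) * ((3 + n) * (3 + n))
        * ((1 + j) * (1 + j) * n * (a * (x * x * (z * (y * y)))))
    regroup = ℕ-Solver.solve-∀
    regroup′ : ∀ δ w d x y → δ * (w * (x * ((1 + d) * y))) ≡ w * (1 + d) * δ * (x * y)
    regroup′ = ℕ-Solver.solve-∀

  companion-ratio₁ : ∀ m k c d → let N = suc m in k + c ≡ 2 + N → k + d ≡ 2 * N →
    δ N * U N k c * companion N (suc k) ≡ G₁-ratio N k c * X N k d
  companion-ratio₁ m k zero d k+0≡3+m _ with trans (sym (ℕP.+-identityʳ k)) k+0≡3+m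
  ... | refl = begin
    δ (suc m) * U (suc m) k 0 * companion (suc m) (3 + suc m)
      ≡⟨ cong (δ (suc m) * U (suc m) k 0 *_) (companion-vanishes (suc m)) ⟩
    δ (suc m) * U (suc m) k 0 * 0
      ≡⟨ ℕP.*-zeroʳ (δ (suc m) * U (suc m) k 0) ⟩
    0 ∎
  companion-ratio₁ m k (suc c) d k+1+c≡3+m k+d≡2N = begin
    δ N * U N k (suc c) * companion N (suc k)
      ≡⟨ regroup N c (k !) (c !) (m !) (companion N (suc k)) ⟩
    δ N * (suc c * suc c * N * (companion N (suc k) * (k ! * k ! * (m ! * (c ! * c !)))))
      ≡⟨ cong (λ x → δ N * (suc c * suc c * N * x)) (companion-factorial m k c k+c≡2+m) ⟩
    δ N * (suc c * suc c * N * ((k + (2 + m)) ! * (m + c) !))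
      ≡⟨ cong₂ (λ x y → δ N * (suc c * suc c * N * (x ! * y !))) (k+[2+m]≡1+N+k m k) m+c≡d ⟩
    δ N * (suc c * suc c * N * ((1 + N + k) ! * d !))
      ≡⟨ regroup′ (δ N) (suc c) N k ((N + k) !) (d !) ⟩
    G₁-ratio N k (suc c) * X N k d
      ∎
    where
    N = suc m
    k+c≡2+m : k + c ≡ 2 + m
    k+c≡2+m = ℕP.suc-injective (trans (sym (ℕP.+-suc k c)) k+1+c≡3+m)
    k+[2+m]≡1+N+k : ∀ m k → k + (2 + m) ≡ 1 + suc m + k
    k+[2+m]≡1+N+k = ℕ-Solver.solve-∀
    m+c≡d : m + c ≡ d
    m+c≡d = ℕP.+-cancelˡ-≡ k _ _ (begin
      k + (m + c)   ≡⟨ shuffle k m c ⟩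
      m + (k + c)   ≡⟨ cong (_+_ m) k+c≡2+m ⟩
      m + (2 + m)   ≡⟨ double m ⟩
      2 * N         ≡⟨ k+d≡2N ⟨
      k + d         ∎)
      where
      shuffle : ∀ k m c → k + (m + c) ≡ m + (k + c)
      shuffle = ℕ-Solver.solve-∀
      double : ∀ m → m + (2 + m) ≡ 2 * suc m
      double = ℕ-Solver.solve-∀
    regroup : ∀ n c x y z a →
      (1 + n) * (1 + n) * (2 + n) * ((3 + n) * (3 + n))
        * (x * x * ((1 + c) * y * ((1 + c) * y)) * (n * z)) * a
      ≡ (1 + n) * (1 + n) * (2 + n) * ((3 + n) * (3 + n))
        * ((1 + c) * (1 + c) * n * (a * (x * x * (z * (y * y)))))
    regroup = ℕ-Solver.solve-∀
    regroup′ : ∀ δ c n k x y → δ * (c * c * n * ((1 + n + k) * x * y)) ≡ c * c * n * (1 + n + k) * δ * (x * y)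
    regroup′ = ℕ-Solver.solve-∀

module IntegerRatios where

  open import Data.Nat using (_+_; _*_)
  open import Data.Integer using (_-_)
  open NaturalCast
  open FactorialForms
  open IntegerPolynomials
  module ℕRatio = NaturalRatios
  module ℕR = SemiringPolynomials ℕ.+-*-rawSemiring (λ m → m)
  module ER = SemiringPolynomials exprRawSemiring ⌜_⌝
  open ≡-Reasoning

  V : ℕ → ℕ → ℕ → ℤ
  V N k c = δ (+ N) ℤ.* + U N k c

  V-nonZero : ∀ N k c → ℤ.NonZero (V N k c)
  V-nonZero N k c = subst ℤ.NonZero (+⟦e⟧ℕ≡⟦e⟧ℤ (ER.δ ⌜ N ⌝ ⊗ ⌜ U N k c ⌝))
                          (ℕP.m*n≢0 (ℕR.δ N) (U N k c) {{_}} {{U-nonZero N k c}})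

  cast-ratio : ∀ N u t r x → ℕR.δ N * u * t ≡ ⟦ r ⟧ℕ * x → δ (+ N) ℤ.* + u ℤ.* + t ≡ ⟦ r ⟧ℤ ℤ.* + x
  cast-ratio N u t r x = cast (ER.δ ⌜ N ⌝ ⊗ ⌜ u ⌝ ⊗ ⌜ t ⌝) (r ⊗ ⌜ x ⌝)

  +n≡+p-+m : ∀ {m n p} → m + n ≡ p → + n ≡ + p - + m
  +n≡+p-+m {m} {n} refl = cancel (+ m) (+ n)
    where
    cancel : ∀ a b → b ≡ a ℤ.+ b - a
    cancel = ℤ-Solver.solve-∀

  +d≡2n-κ : ∀ {N k d} → k + d ≡ 2 * N → + d ≡ + 2 ℤ.* + N - + k
  +d≡2n-κ {N} {k} k+d≡2N = trans (+n≡+p-+m k+d≡2N) (cong (_- + k) (ℤP.pos-* 2 N))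

  both-vanish : ∀ {v r x t} → t ≡ 0 → r ≡ 0ℤ → v ℤ.* + t ≡ r ℤ.* x
  both-vanish {v} {x = x} refl refl = trans (ℤP.*-zeroʳ v) (sym (ℤP.*-zeroˡ x))

  private
    k+b≡N : ∀ {N k b} → k + (2 + b) ≡ 2 + N → k + b ≡ N
    k+b≡N {N} {k} {b} eq = ℕP.+-cancelˡ-≡ 2 _ _ (trans (shuffle k b) eq)
      where
      shuffle : ∀ k b → 2 + (k + b) ≡ k + (2 + b)
      shuffle = ℕ-Solver.solve-∀

    d≡k+b+b : ∀ {k b d} → k + d ≡ 2 * (k + b) → d ≡ k + b + b
    d≡k+b+b {k} {b} eq = ℕP.+-cancelˡ-≡ k _ _ (trans eq (double k b))
      where
      double : ∀ k b → 2 * (k + b) ≡ k + (k + b + b)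
      double = ℕ-Solver.solve-∀

  -- For k > N the summand vanishes, and so does ρF₀ through its factor (1 + b)(2 + b).
  summand-ratio₀ : ∀ N k c d → k + c ≡ 2 + N → k + d ≡ 2 * N →
    V N k c ℤ.* + summand N k ≡ ρF₀ (+ N) (+ k) ℤ.* + X N k d
  summand-ratio₀ N k 0 d k+0≡2+N _ with trans (sym (ℕP.+-identityʳ k)) k+0≡2+N
  ... | refl = both-vanish {V N (2 + N) 0} {x = + X N (2 + N) d}
                           (summand-vanishes (ℕP.m<n+m N (s≤s z≤n))) (ρF₀[n,2+n]≡0 (+ N))
  summand-ratio₀ N k 1 d k+1≡2+N _ with ℕP.suc-injective (trans (ℕP.+-comm 1 k) k+1≡2+N)
  ... | refl = both-vanish {V N (1 + N) 1} {x = + X N (1 + N) d}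
                           (summand-vanishes (ℕP.n<1+n N)) (ρF₀[n,1+n]≡0 (+ N))
  summand-ratio₀ N k (suc (suc b)) d k+2+b≡2+N k+d≡2N with k+b≡N {N} {k} {b} k+2+b≡2+N
  ... | refl with d≡k+b+b {k} {b} {d} k+d≡2N
  ... | refl = begin
    V N k (2 + b) ℤ.* + summand N k
      ≡⟨ cast-ratio N (U N k (2 + b)) (summand N k) (ER.F₀-ratio ⌜ N ⌝ ⌜ k ⌝ ⌜ b ⌝) (X N k (N + b))
                    (ℕRatio.summand-ratio₀ k b) ⟩
    F₀-ratio (+ N) (+ k) (+ b) ℤ.* + X N k (N + b)
      ≡⟨ cong (λ e → F₀-ratio (+ N) (+ k) e ℤ.* + X N k (N + b)) (+n≡+p-+m {k} {b} refl) ⟩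
    ρF₀ (+ N) (+ k) ℤ.* + X N k (N + b)
      ∎

  summand-ratio₂ : ∀ {N k c d} → k + c ≡ 2 + N → k + d ≡ 2 * N →
    V N k c ℤ.* + summand (2 + N) k ≡ ρF₂ (+ N) (+ k) ℤ.* + X N k d
  summand-ratio₂ {N} {k} {c} {d} k+c≡2+N k+d≡2N = begin
    V N k c ℤ.* + summand (2 + N) k
      ≡⟨ cast-ratio N (U N k c) (summand (2 + N) k) (ER.F₂-ratio ⌜ N ⌝ ⌜ k ⌝ ⌜ c ⌝ ⌜ d ⌝) (X N k d)
                    (ℕRatio.summand-ratio₂ N k c d k+c≡2+N k+d≡2N) ⟩
    F₂-ratio (+ N) (+ k) (+ c) (+ d) ℤ.* + X N k d
      ≡⟨ cong₂ (λ x y → F₂-ratio (+ N) (+ k) x y ℤ.* + X N k d)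
               (+n≡+p-+m {k} {c} {2 + N} k+c≡2+N) (+d≡2n-κ {N} {k} {d} k+d≡2N) ⟩
    ρF₂ (+ N) (+ k) ℤ.* + X N k d
      ∎

  module _ {m k c d : ℕ} (k+c≡2+N : k + c ≡ 2 + suc m) (k+d≡2N : k + d ≡ 2 * suc m) where

    private
      N = suc m

    companion-ratio₀ : V N k c ℤ.* + companion N k ≡ ρG₀ (+ N) (+ k) ℤ.* + X N k d
    companion-ratio₀ = begin
      V N k c ℤ.* + companion N k
        ≡⟨ cast-ratio N (U N k c) (companion N k) (ER.G₀-ratio ⌜ N ⌝ ⌜ k ⌝ ⌜ d ⌝) (X N k d)
                      (ℕRatio.companion-ratio₀ m k c d k+c≡2+N k+d≡2N) ⟩
      G₀-ratio (+ N) (+ k) (+ d) ℤ.* + X N k d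
        ≡⟨ cong (λ e → G₀-ratio (+ N) (+ k) e ℤ.* + X N k d) (+d≡2n-κ {N} {k} {d} k+d≡2N) ⟩
      ρG₀ (+ N) (+ k) ℤ.* + X N k d
        ∎

    companion-ratio₁ : V N k c ℤ.* + companion N (suc k) ≡ ρG₁ (+ N) (+ k) ℤ.* + X N k d
    companion-ratio₁ = begin
      V N k c ℤ.* + companion N (suc k)
        ≡⟨ cast-ratio N (U N k c) (companion N (suc k)) (ER.G₁-ratio ⌜ N ⌝ ⌜ k ⌝ ⌜ c ⌝) (X N k d)
                      (ℕRatio.companion-ratio₁ m k c d k+c≡2+N k+d≡2N) ⟩
      G₁-ratio (+ N) (+ k) (+ c) ℤ.* + X N k d
        ≡⟨ cong (λ e → G₁-ratio (+ N) (+ k) e ℤ.* + X N k d) (+n≡+p-+m {k} {c} {2 + N} k+c≡2+N) ⟩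
      ρG₁ (+ N) (+ k) ℤ.* + X N k d
        ∎

module WZPair where

  open import Data.Integer using (_+_; _-_; _*_; -_)
  open IntegerPolynomials
  open FactorialForms
  open IntegerRatios
  open ≡-Reasoning

  F : ℕ → ℕ → ℤ
  F N k = sgn k * + summand N k

  G : ℕ → ℕ → ℤ
  G N k = sgn k * (Y (+ N) (+ k) * + companion N k)

  c₀ c₂ : ℕ → ℤ
  c₀ N = rising₄ (+ N) * p₀ (+ N)
  c₂ N = rising₄ (+ N) * p₂ (+ N)

  wz-relation : ∀ {n κ v x P₀ P₂ A₀ A₁} .{{_ : ℤ.NonZero v}} →
    v * P₀ ≡ ρF₀ n κ * x → v * P₂ ≡ ρF₂ n κ * x → v * A₀ ≡ ρG₀ n κ * x → v * A₁ ≡ ρG₁ n κ * x →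
    rising₄ n * p₀ n * P₀ + rising₄ n * p₂ n * P₂ + Y n (+ 1 + κ) * A₁ + Y n κ * A₀ ≡ 0ℤ
  wz-relation {n} {κ} {v} {x} {P₀} {P₂} {A₀} {A₁} vP₀ vP₂ vA₀ vA₁ = ℤP.*-cancelˡ-≡ v _ 0ℤ (begin
    v * (c₀′ * P₀ + c₂′ * P₂ + y₁ * A₁ + y₀ * A₀)
      ≡⟨ distribute v c₀′ c₂′ y₁ y₀ P₀ P₂ A₁ A₀ ⟩
    c₀′ * (v * P₀) + c₂′ * (v * P₂) + y₁ * (v * A₁) + y₀ * (v * A₀)
      ≡⟨ cong₂ _+_ (cong₂ _+_ (cong₂ _+_ (cong (c₀′ *_) vP₀) (cong (c₂′ *_) vP₂)) (cong (y₁ *_) vA₁)) (cong (y₀ *_) vA₀) ⟩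
    c₀′ * (ρF₀ n κ * x) + c₂′ * (ρF₂ n κ * x) + y₁ * (ρG₁ n κ * x) + y₀ * (ρG₀ n κ * x)
      ≡⟨ factor c₀′ c₂′ y₁ y₀ (ρF₀ n κ) (ρF₂ n κ) (ρG₁ n κ) (ρG₀ n κ) x ⟩
    wz-combination n κ * x
      ≡⟨ cong (_* x) (wz-certificate n κ) ⟩
    0ℤ * x
      ≡⟨ ℤP.*-zeroˡ x ⟩
    0ℤ
      ≡⟨ ℤP.*-zeroʳ v ⟨
    v * 0ℤ
      ∎)
    where
    c₀′ = rising₄ n * p₀ n
    c₂′ = rising₄ n * p₂ n
    y₁ = Y n (+ 1 + κ)
    y₀ = Y n κ
    distribute : ∀ v a b c d p q r s →
      v * (a * p + b * q + c * r + d * s) ≡ a * (v * p) + b * (v * q) + c * (v * r) + d * (v * s)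
    distribute = ℤ-Solver.solve-∀
    factor : ∀ a b c d p q r s x →
      a * (p * x) + b * (q * x) + c * (r * x) + d * (s * x) ≡ (a * p + b * q + c * r + d * s) * x
    factor = ℤ-Solver.solve-∀

  wz-step : ∀ m k → let N = 2 ℕ.+ m in k ≤ 2 ℕ.+ N →
    c₀ N * F N k + c₂ N * F (2 ℕ.+ N) k ≡ G N (suc k) - G N k
  wz-step m k k≤2+N = begin
    c₀ N * (s * P₀) + c₂ N * (s * P₂)
      ≡⟨ rearrange (c₀ N) (c₂ N) s P₀ P₂ y₁ A₁ y₀ A₀ ⟩
    - s * (y₁ * A₁) - s * (y₀ * A₀) + s * (c₀ N * P₀ + c₂ N * P₂ + y₁ * A₁ + y₀ * A₀)
      ≡⟨ cong (λ e → - s * (y₁ * A₁) - s * (y₀ * A₀) + s * e) relation ⟩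
    - s * (y₁ * A₁) - s * (y₀ * A₀) + s * 0ℤ
      ≡⟨ cong (_+_ (- s * (y₁ * A₁) - s * (y₀ * A₀))) (ℤP.*-zeroʳ s) ⟩
    - s * (y₁ * A₁) - s * (y₀ * A₀) + 0ℤ
      ≡⟨ ℤP.+-identityʳ _ ⟩
    G N (suc k) - G N k
      ∎
    where
    N = 2 ℕ.+ m
    c = 2 ℕ.+ N ∸ k
    d = 2 ℕ.* N ∸ k
    s = sgn k
    P₀ = + summand N k
    P₂ = + summand (2 ℕ.+ N) k
    A₀ = + companion N k
    A₁ = + companion N (suc k)
    y₀ = Y (+ N) (+ k)
    y₁ = Y (+ N) (+ 1 + + k)
    k+c≡2+N : k ℕ.+ c ≡ 2 ℕ.+ N
    k+c≡2+N = ℕP.m+[n∸m]≡n k≤2+N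
    k+d≡2N : k ℕ.+ d ≡ 2 ℕ.* N
    k+d≡2N = ℕP.m+[n∸m]≡n (ℕP.≤-trans k≤2+N (2+N≤2N m))
      where
      2+N≤2N : ∀ m → 4 ℕ.+ m ≤ 2 ℕ.* (2 ℕ.+ m)
      2+N≤2N m = subst (4 ℕ.+ m ℕ.≤_) (double m) (ℕP.m≤m+n (4 ℕ.+ m) m)
        where
        double : ∀ m → 4 ℕ.+ m ℕ.+ m ≡ 2 ℕ.* (2 ℕ.+ m)
        double = ℕ-Solver.solve-∀
    relation : c₀ N * P₀ + c₂ N * P₂ + y₁ * A₁ + y₀ * A₀ ≡ 0ℤ
    relation = wz-relation {+ N} {+ k} {V N k c} {+ X N k d} {{V-nonZero N k c}}
      (summand-ratio₀ N k c d k+c≡2+N k+d≡2N) (summand-ratio₂ {N} {k} {c} {d} k+c≡2+N k+d≡2N)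
      (companion-ratio₀ {suc m} {k} {c} {d} k+c≡2+N k+d≡2N) (companion-ratio₁ {suc m} {k} {c} {d} k+c≡2+N k+d≡2N)
    rearrange : ∀ a b s p q y₁ r y₀ t →
      a * (s * p) + b * (s * q) ≡ - s * (y₁ * r) - s * (y₀ * t) + s * (a * p + b * q + y₁ * r + y₀ * t)
    rearrange = ℤ-Solver.solve-∀

module SumRecurrence where

  open import Data.Integer using (_+_; _-_; _*_; -_)
  open IntegerPolynomials
  open FactorialForms
  open FiniteSums
  open WZPair
  open ≡-Reasoning

  S : ℕ → ℤ
  S N = sumTo N (F N)

  F-vanishes : ∀ {N k} → N < k → F N k ≡ 0ℤ
  F-vanishes {N} {k} N<k = trans (cong (λ t → sgn k * + t) (summand-vanishes N<k)) (ℤP.*-zeroʳ (sgn k))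

  G-vanishes-at-0 : ∀ N → G N 0 ≡ 0ℤ
  G-vanishes-at-0 N = trans (ℤP.*-identityˡ _) (ℤP.*-zeroʳ (Y (+ N) 0ℤ))

  G-vanishes-at-3+N : ∀ N → G N (3 ℕ.+ N) ≡ 0ℤ
  G-vanishes-at-3+N N = begin
    sgn (3 ℕ.+ N) * (Y (+ N) (+ (3 ℕ.+ N)) * + companion N (3 ℕ.+ N))
      ≡⟨ cong (λ t → sgn (3 ℕ.+ N) * (Y (+ N) (+ (3 ℕ.+ N)) * + t)) (companion-vanishes N) ⟩
    sgn (3 ℕ.+ N) * (Y (+ N) (+ (3 ℕ.+ N)) * 0ℤ)
      ≡⟨ cong (sgn (3 ℕ.+ N) *_) (ℤP.*-zeroʳ (Y (+ N) (+ (3 ℕ.+ N)))) ⟩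
    sgn (3 ℕ.+ N) * 0ℤ
      ≡⟨ ℤP.*-zeroʳ (sgn (3 ℕ.+ N)) ⟩
    0ℤ ∎

  S≡∑<[3+N] : ∀ N → S N ≡ ∑< (3 ℕ.+ N) (F N)
  S≡∑<[3+N] N = begin
    S N                      ≡⟨ sumTo≡∑< N (F N) ⟩
    ∑< (suc N) (F N)         ≡⟨ ∑<-pad (suc N) 2 (F N) (λ k → F-vanishes) ⟨
    ∑< (suc N ℕ.+ 2) (F N)   ≡⟨ cong (λ m → ∑< m (F N)) (ℕP.+-comm (suc N) 2) ⟩
    ∑< (3 ℕ.+ N) (F N)       ∎

  S-recurrence : ∀ m → let N = 2 ℕ.+ m in p₀ (+ N) * S N + p₂ (+ N) * S (2 ℕ.+ N) ≡ 0ℤ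
  S-recurrence m = ℤP.*-cancelˡ-≡ (rising₄ (+ N)) _ 0ℤ {{rising₄[1+n]-nonZero (suc m)}} (begin
    rising₄ (+ N) * (p₀ (+ N) * S N + p₂ (+ N) * S (2 ℕ.+ N))
      ≡⟨ ℤP.*-distribˡ-+ (rising₄ (+ N)) (p₀ (+ N) * S N) (p₂ (+ N) * S (2 ℕ.+ N)) ⟩
    rising₄ (+ N) * (p₀ (+ N) * S N) + rising₄ (+ N) * (p₂ (+ N) * S (2 ℕ.+ N))
      ≡⟨ cong₂ _+_ (ℤP.*-assoc (rising₄ (+ N)) (p₀ (+ N)) (S N)) (ℤP.*-assoc (rising₄ (+ N)) (p₂ (+ N)) (S (2 ℕ.+ N))) ⟨
    c₀ N * S N + c₂ N * S (2 ℕ.+ N)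
      ≡⟨ cong₂ (λ x y → c₀ N * x + c₂ N * y) (S≡∑<[3+N] N) (sumTo≡∑< (2 ℕ.+ N) (F (2 ℕ.+ N))) ⟩
    c₀ N * ∑< (3 ℕ.+ N) (F N) + c₂ N * ∑< (3 ℕ.+ N) (F (2 ℕ.+ N))
      ≡⟨ ∑<-linear (3 ℕ.+ N) (c₀ N) (c₂ N) (F N) (F (2 ℕ.+ N)) ⟨
    ∑< (3 ℕ.+ N) (λ k → c₀ N * F N k + c₂ N * F (2 ℕ.+ N) k)
      ≡⟨ ∑<-cong (3 ℕ.+ N) _ _ (λ k k<3+N → wz-step m k (ℕP.≤-pred k<3+N)) ⟩
    ∑< (3 ℕ.+ N) (λ k → G N (suc k) - G N k)
      ≡⟨ ∑<-telescope (3 ℕ.+ N) (G N) ⟩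
    G N (3 ℕ.+ N) - G N 0
      ≡⟨ cong₂ _-_ (G-vanishes-at-3+N N) (G-vanishes-at-0 N) ⟩
    0ℤ
      ≡⟨ ℤP.*-zeroʳ (rising₄ (+ N)) ⟨
    rising₄ (+ N) * 0ℤ
      ∎)
    where
    N = 2 ℕ.+ m

  S[2+2n]-recurrence : ∀ n →
    p₀ (+ (2 ℕ.* suc n)) * S (2 ℕ.* suc n) + p₂ (+ (2 ℕ.* suc n)) * S (2 ℕ.* suc (suc n)) ≡ 0ℤ
  S[2+2n]-recurrence n = subst₂ (λ N M → p₀ (+ N) * S N + p₂ (+ N) * S M ≡ 0ℤ)
                                (2+2n≡2[1+n] n) (4+2n≡2[2+n] n) (S-recurrence (2 ℕ.* n))
    where
    2+2n≡2[1+n] : ∀ n → 2 ℕ.+ 2 ℕ.* n ≡ 2 ℕ.* suc n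
    2+2n≡2[1+n] = ℕ-Solver.solve-∀
    4+2n≡2[2+n] : ∀ n → 2 ℕ.+ (2 ℕ.+ 2 ℕ.* n) ≡ 2 ℕ.* suc (suc n)
    4+2n≡2[2+n] = ℕ-Solver.solve-∀

module ClosedForm where

  open import Data.Nat using (_+_; _*_)
  open Binomials
  open SemiringPolynomials ℕ.+-*-rawSemiring (λ m → m)
  open ≡-Reasoning

  catalanProduct : ℕ → ℕ
  catalanProduct n = fussCatalan3 n * catalan n

  catalanProduct-factorial : ∀ n → catalanProduct n * (suc (2 * n) * suc n) * (n ! * n ! * n !) ≡ (3 * n) !
  catalanProduct-factorial n = ℕP.*-cancelʳ-≡ _ _ ((2 * n) !) {{ℕP._!≢0 (2 * n)}} (begin
    fussCatalan3 n * catalan n * (suc (2 * n) * suc n) * (n ! * n ! * n !) * (2 * n) !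
      ≡⟨ regroup (fussCatalan3 n) (catalan n) (suc (2 * n)) (suc n) (n !) ((2 * n) !) ⟩
    fussCatalan3 n * suc (2 * n) * (catalan n * suc n) * (n ! * (2 * n) !) * (n ! * n !)
      ≡⟨ cong₂ (λ x y → x * y * (n ! * (2 * n) !) * (n ! * n !)) (fussCatalan3*[1+2n]≡[3n]Cn n) (catalan*[1+n]≡[2n]Cn n) ⟩
    ((3 * n) C n) * ((2 * n) C n) * (n ! * (2 * n) !) * (n ! * n !)
      ≡⟨ regroup′ ((3 * n) C n) ((2 * n) C n) (n ! * (2 * n) !) (n ! * n !) ⟩
    ((3 * n) C n) * (n ! * (2 * n) !) * (((2 * n) C n) * (n ! * n !))
      ≡⟨ cong₂ _*_ [3n]Cn-factorial [2n]Cn-factorial ⟩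
    (3 * n) ! * (2 * n) !
      ∎)
    where
    [3n]Cn-factorial : ((3 * n) C n) * (n ! * (2 * n) !) ≡ (3 * n) !
    [3n]Cn-factorial = subst (λ m → (m C n) * (n ! * (2 * n) !) ≡ m !) (n+2n≡3n n) ([m+n]Cm*[m!*n!]≡[m+n]! n (2 * n))
      where
      n+2n≡3n : ∀ n → n + 2 * n ≡ 3 * n
      n+2n≡3n = ℕ-Solver.solve-∀
    [2n]Cn-factorial : ((2 * n) C n) * (n ! * n !) ≡ (2 * n) !
    [2n]Cn-factorial = subst (λ m → (m C n) * (n ! * n !) ≡ m !) (n+n≡2n n) ([m+n]Cm*[m!*n!]≡[m+n]! n n)
      where
      n+n≡2n : ∀ n → n + n ≡ 2 * n
      n+n≡2n = ℕ-Solver.solve-∀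
    regroup : ∀ a b c d x y → a * b * (c * d) * (x * x * x) * y ≡ a * c * (b * d) * (x * y) * (x * x)
    regroup = ℕ-Solver.solve-∀
    regroup′ : ∀ a b u v → a * b * u * v ≡ a * u * (b * v)
    regroup′ = ℕ-Solver.solve-∀

  catalanProduct-growth : ∀ n → catalanProduct (suc n) * growthDenominator n ≡ growthNumerator n * catalanProduct n
  catalanProduct-growth n = ℕP.*-cancelʳ-≡ _ _ (suc n * suc n * (n ! * n ! * n !)) {{nonZero}} (begin
    a′ * growthDenominator n * (suc n * suc n * (n ! * n ! * n !))
      ≡⟨ regroup n a′ (n !) ⟩
    a′ * (suc (2 * suc n) * suc (suc n)) * (suc n ! * suc n ! * suc n !)
      ≡⟨ catalanProduct-factorial (suc n) ⟩
    (3 * suc n) !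
      ≡⟨ cong _! (3[1+n]≡3+3n n) ⟩
    (3 + 3 * n) !
      ≡⟨ cong (λ x → (3 + 3 * n) * ((2 + 3 * n) * ((1 + 3 * n) * x))) (catalanProduct-factorial n) ⟨
    (3 + 3 * n) * ((2 + 3 * n) * ((1 + 3 * n) * (a * (suc (2 * n) * suc n) * (n ! * n ! * n !))))
      ≡⟨ regroup′ n a (n !) ⟩
    growthNumerator n * a * (suc n * suc n * (n ! * n ! * n !))
      ∎)
    where
    a = catalanProduct n
    a′ = catalanProduct (suc n)
    nonZero : ℕ.NonZero (suc n * suc n * (n ! * n ! * n !))
    nonZero = ℕP.m*n≢0 (suc n * suc n) (n ! * n ! * n !)
      {{_}} {{ℕP.m*n≢0 (n ! * n !) (n !) {{ℕP.m*n≢0 (n !) (n !) {{ℕP._!≢0 n}} {{ℕP._!≢0 n}}}} {{ℕP._!≢0 n}}}}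
    3[1+n]≡3+3n : ∀ n → 3 * suc n ≡ 3 + 3 * n
    3[1+n]≡3+3n = ℕ-Solver.solve-∀
    regroup : ∀ n a x →
      a * ((1 + n) * (2 + n) * (3 + 2 * n)) * ((1 + n) * (1 + n) * (x * x * x))
      ≡ a * (suc (2 * suc n) * suc (suc n)) * ((1 + n) * x * ((1 + n) * x) * ((1 + n) * x))
    regroup = ℕ-Solver.solve-∀
    regroup′ : ∀ n a x →
      (3 + 3 * n) * ((2 + 3 * n) * ((1 + 3 * n) * (a * (suc (2 * n) * suc n) * (x * x * x))))
      ≡ 3 * (1 + 3 * n) * (2 + 3 * n) * (1 + 2 * n) * a * ((1 + n) * (1 + n) * (x * x * x))
    regroup′ = ℕ-Solver.solve-∀

module ClosedFormRecurrence where

  open import Data.Integer using (_+_; _-_; _*_; -_)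
  open NaturalCast
  open ClosedForm
  open IntegerPolynomials
  module ER = SemiringPolynomials exprRawSemiring ⌜_⌝
  open ≡-Reasoning

  R : ℕ → ℤ
  R n = sgn n * + (fussCatalan3 n ℕ.* catalan n ℕ.* (2 ℕ.* n ℕ.* n ℕ.+ n ℕ.+ 1))

  R-factorised : ∀ n → R n ≡ sgn n * (+ catalanProduct n * q (+ n))
  R-factorised n = cong (sgn n *_) (+⟦e⟧ℕ≡⟦e⟧ℤ (⌜ catalanProduct n ⌝ ⊗ ER.q ⌜ n ⌝))

  +catalanProduct-growth : ∀ n →
    + catalanProduct (suc n) * growthDenominator (+ n) ≡ growthNumerator (+ n) * + catalanProduct n
  +catalanProduct-growth n =
    cast (⌜ catalanProduct (suc n) ⌝ ⊗ ER.growthDenominator ⌜ n ⌝) (ER.growthNumerator ⌜ n ⌝ ⊗ ⌜ catalanProduct n ⌝)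
         (catalanProduct-growth n)

  R-recurrence : ∀ n → p₀ (+ (2 ℕ.* n)) * R n + p₂ (+ (2 ℕ.* n)) * R (suc n) ≡ 0ℤ
  R-recurrence n = ℤP.*-cancelˡ-≡ w _ 0ℤ {{growthDenominator-nonZero n}} (begin
    w * (p₀ (+ (2 ℕ.* n)) * R n + p₂ (+ (2 ℕ.* n)) * R (suc n))
      ≡⟨ cong (λ x → w * (p₀ x * R n + p₂ x * R (suc n))) 2n≡2*n ⟩
    w * (p₀ 2n * R n + p₂ 2n * R (suc n))
      ≡⟨ cong₂ (λ x y → w * (p₀ 2n * x + p₂ 2n * y)) (R-factorised n) (R-factorised (suc n)) ⟩
    w * (p₀ 2n * (s * (a * q (+ n))) + p₂ 2n * (- s * (a′ * q (+ 1 + + n))))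
      ≡⟨ regroup w (p₀ 2n) (p₂ 2n) s a a′ (q (+ n)) (q (+ 1 + + n)) ⟩
    s * (p₀ 2n * w * q (+ n) * a - p₂ 2n * q (+ 1 + + n) * (a′ * w))
      ≡⟨ cong (λ x → s * (p₀ 2n * w * q (+ n) * a - p₂ 2n * q (+ 1 + + n) * x)) (+catalanProduct-growth n) ⟩
    s * (p₀ 2n * w * q (+ n) * a - p₂ 2n * q (+ 1 + + n) * (growthNumerator (+ n) * a))
      ≡⟨ regroup′ (p₀ 2n * w * q (+ n)) (p₂ 2n * q (+ 1 + + n)) (growthNumerator (+ n)) s a ⟩
    s * a * closed-form-combination (+ n)
      ≡⟨ cong (s * a *_) (closed-form-certificate (+ n)) ⟩
    s * a * 0ℤ
      ≡⟨ ℤP.*-zeroʳ (s * a) ⟩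
    0ℤ
      ≡⟨ ℤP.*-zeroʳ w ⟨
    w * 0ℤ
      ∎)
    where
    w = growthDenominator (+ n)
    2n = + 2 * + n
    s = sgn n
    a = + catalanProduct n
    a′ = + catalanProduct (suc n)
    2n≡2*n : + (2 ℕ.* n) ≡ 2n
    2n≡2*n = ℤP.pos-* 2 n
    regroup : ∀ w x y s a a′ q q′ →
      w * (x * (s * (a * q)) + y * (- s * (a′ * q′))) ≡ s * (x * w * q * a - y * q′ * (a′ * w))
    regroup = ℤ-Solver.solve-∀
    regroup′ : ∀ u v g s a → s * (u * a - v * (g * a)) ≡ s * a * (u - v * g)
    regroup′ = ℤ-Solver.solve-∀

open import Data.Nat using (_+_; _*_)
open IntegerPolynomials using (p₀; p₂; p₂-nonZero)
open SumRecurrence using (S; S[2+2n]-recurrence)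
open ClosedFormRecurrence using (R; R-recurrence)
open FirstOrderRecurrence using (recurrence-unique)

theorem1 : (n : ℕ) →
    sumTo (2 * n) (λ k → sgn k ℤ.* (+ (((2 * n) C k) * catTri (2 * n) k * catTri (2 * n) (2 * n ∸ k))))
    ≡ sgn n ℤ.* (+ (fussCatalan3 n * catalan n * (2 * n * n + n + 1)))
theorem1 zero    = refl
-- The recurrence for S needs N ≥ 2, so the comparison starts from S(2) = R(1), checked by evaluation.
theorem1 (suc n) =
  recurrence-unique (λ m → p₀ (+ (2 * suc m))) (λ m → p₂ (+ (2 * suc m)))
                    (λ m → S (2 * suc m)) (λ m → R (suc m))
                    (λ m → p₂-nonZero (2 * suc m)) S[2+2n]-recurrence (R-recurrence ∘ suc)
                    refl n
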